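{- Let $G=(V,E)$ be a graph with $n=|V|$ vertices, let $M$ be a perfect matching of $G$, and let $k,l$ be integers. For $F\subseteq M$, let $V(F)$ be the set of end vertices of edges of $F$, and define the graph $G^F=(V^F,E^F)$ by $V^F_1=\{v_1: v\in V\setminus V(F)\}$, $V^F_2=\{v_2 : v\in V\}$ (fresh copies), $V^F=V^F_1\cup V^F_2$, and $E^F=\{\{v_1,v_2\}: v\in V\setminus V(F)\}\cup\{\{u_i,v_i\}:\{u,v\}\in E,\ u_i,v_i\in V^F_i,\ i\in\{1,2\}\}$. Define $w_F:V^F\to\mathbb{Z}_{\ge 0}$ by $w_F(v)=k+1$ for $v\in V^F_1$ and $w_F(v)=1$ for $v\in V^F_2$, and set $k_F=\left(\frac n2-|F|\right)(k+2)+k$. Then $G$ has a vertex set $X\subseteq V$ with $|X|\le k$ such that $G-X$ is bipartite with color classes $(A,B)$ satisfying $|A|\ge \frac n2 - l$ if and only if there exists $F\subseteq M$ with $|F|\le l$ such that $G^F$ has a vertex cover of total $w_F$-weight at most $k_F$.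
   Context: A vertex cover of a graph is a set of vertices meeting every edge; its weight under a vertex-weight function is the sum of the weights of its vertices. -}

module Defs where

open import Data.Nat using (ℕ; zero; suc; _+_; _*_; _≤_)
open import Data.Bool using (Bool; true; false; if_then_else_)
open import Data.Fin using (Fin; zero; suc)
open import Data.Fin.Subset using (Subset; _∈_; _∉_; ∣_∣)
open import Data.Fin.Subset.Properties using (_∈?_)
open import Data.Product using (Σ; ∃; ∃-syntax; _×_; _,_; proj₁; proj₂)
open import Data.Sum using (_⊎_; inj₁; inj₂)
open import Data.Empty using (⊥)
open import Relation.Nullary using (¬_; yes; no)
open import Relation.Binary.PropositionalEquality using (_≡_)

record Graph (n : ℕ) : Set where
  field
    E      : Fin n → Fin n → Bool
    sym    : ∀ u v → E u v ≡ E v u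
    irrefl : ∀ v → E v v ≡ false

open Graph public

Adj : ∀ {n} → Graph n → Fin n → Fin n → Set
Adj G u v = E G u v ≡ true

record PerfectMatching {n : ℕ} (G : Graph n) : Set where
  field
    m       : ℕ
    edge    : Fin m → Fin n × Fin n
    isEdge  : ∀ i → Adj G (proj₁ (edge i)) (proj₂ (edge i))
  EndOf : Fin n → Fin m → Set
  EndOf v i = (v ≡ proj₁ (edge i)) ⊎ (v ≡ proj₂ (edge i))
  field
    covers  : ∀ v → ∃[ i ] EndOf v i
    unique  : ∀ v i j → EndOf v i → EndOf v j → i ≡ j

open PerfectMatching public

InVF : ∀ {n} {G : Graph n} (M : PerfectMatching G) → Subset (m M) → Fin n → Set
InVF M F v = ∃[ i ] (i ∈ F × EndOf M v i)

IsBipartition : ∀ {n} → Graph n → (X A B : Subset n) → Set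
IsBipartition G X A B =
    (∀ v → v ∈ A → v ∉ X)
  × (∀ v → v ∈ B → v ∉ X)
  × (∀ v → v ∉ X → v ∈ A ⊎ v ∈ B)
  × (∀ v → v ∈ A → v ∉ B)
  × (∀ u v → u ∈ A → v ∈ A → ¬ Adj G u v)
  × (∀ u v → u ∈ B → v ∈ B → ¬ Adj G u v)

-- The graph G^F.  Its vertices are represented inside Fin n ⊎ Fin n:
-- inj₁ v stands for v₁ and inj₂ v for v₂.
VertexGF : ∀ {n} {G : Graph n} (M : PerfectMatching G) → Subset (m M) → Fin n ⊎ Fin n → Set
VertexGF M F (inj₁ v) = ¬ InVF M F v
VertexGF M F (inj₂ v) = Data.Unit.⊤
  where import Data.Unit

EdgeGF : ∀ {n} {G : Graph n} (M : PerfectMatching G) → Subset (m M) →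
         Fin n ⊎ Fin n → Fin n ⊎ Fin n → Set
EdgeGF M F (inj₁ u) (inj₂ v) = (u ≡ v) × ¬ InVF M F u
EdgeGF M F (inj₂ u) (inj₁ v) = (u ≡ v) × ¬ InVF M F u
EdgeGF {G = G} M F (inj₁ u) (inj₁ v) = Adj G u v × ¬ InVF M F u × ¬ InVF M F v
EdgeGF {G = G} M F (inj₂ u) (inj₂ v) = Adj G u v

-- membership of a vertex of G^F in a set given by its two layers (C₁ , C₂)
_∈GF_ : ∀ {n} → Fin n ⊎ Fin n → Subset n × Subset n → Set
inj₁ v ∈GF C = v ∈ proj₁ C
inj₂ v ∈GF C = v ∈ proj₂ C

IsVertexCoverGF : ∀ {n} {G : Graph n} (M : PerfectMatching G) (F : Subset (m M)) →
                  Subset n × Subset n → Set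
IsVertexCoverGF M F C =
    (∀ x → x ∈GF C → VertexGF M F x)
  × (∀ x y → EdgeGF M F x y → x ∈GF C ⊎ y ∈GF C)

sumOver : ∀ {n} → Subset n → (Fin n → ℕ) → ℕ
sumOver {n} S f = go n S f
  where
  go : ∀ n → Subset n → (Fin n → ℕ) → ℕ
  go zero    _ _ = 0
  go (suc n) S f with zero ∈? S
  ... | yes _ = f zero + go n (Data.Vec.tail S) (λ i → f (suc i))
    where import Data.Vec
  ... | no  _ = go n (Data.Vec.tail S) (λ i → f (suc i))
    where import Data.Vec

wF : ∀ {n} → ℕ → Fin n ⊎ Fin n → ℕ
wF k (inj₁ _) = suc k
wF k (inj₂ _) = 1

weightGF : ∀ {n} → ℕ → Subset n × Subset n → ℕ
weightGF k (C₁ , C₂) = sumOver C₁ (λ v → wF k (inj₁ v)) + sumOver C₂ (λ v → wF k (inj₂ v))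

-- Write t for the number of matching edges outside F; the vertices outside V(F) are exactly
-- the 2t ends of these edges, and k_F = t(k+2) + k.
-- From a bipartition (A, B) of G − X, let F be the matching edges with no end in A. As A is
-- independent, every other matching edge has exactly one end in A, so t ≥ |A| and
-- |F| ≤ n/2 − |A| ≤ l. Cover the first layer by the ends outside A of the edges outside F
-- (at most t vertices of weight k+1) and the second layer by V ∖ B (at most |X| + |A| ≤ k + t
-- vertices of weight 1).
-- Conversely, from a cover C₁ ∪ C₂ of G^F let A be the v ∉ V(F) with v₁ ∉ C₁, B the v with
-- v₂ ∉ C₂, and X = C₂ ∖ A. The rungs v₁v₂ and the two copies of G make this a bipartition of
-- G − X. As A and B are independent, |A| ≤ t and |B| ≤ n/2 ≤ |C₂|. If |A| < t then
-- |C₁| ≥ 2t − |A| ≥ t + 1, and the weight would be at least (k+1)(t+1) + t > k_F. Hence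
-- |A| = t, |C₁| ≥ t, |C₂| ≤ k + t and |X| ≤ |C₂| − |A| ≤ k.
module Submission where

open import Defs
open import Data.Nat using (ℕ; suc; _+_; _*_; _∸_; _≤_; _/_; z≤n; s≤s)
open import Data.Nat.Properties hiding (_≟_; suc-injective; 0≢1+n)
open import Data.Nat.DivMod using (m*n/n≡m)
open import Data.Nat.Tactic.RingSolver using (solve-∀)
open import Data.Bool using (true; false)
open import Data.Fin using (Fin; zero; suc; _≟_)
open import Data.Fin.Properties using (suc-injective; 0≢1+n)
open import Data.Fin.Subset using (Subset; _∈_; _∉_; ∣_∣; ⊤; ∁; _∩_; _∪_; _-_)
open import Data.Fin.Subset.Properties
  using (_∈?_; ∈⊤; ∣⊤∣≡n; ∣p∣≤n; p⊆q⇒∣p∣≤∣q∣; x∈p⇒∣p-x∣<∣p∣; x∈p∧x≢y⇒x∈p-y;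
         x∈p∩q⁺; x∈p∩q⁻; x∈p∪q⁺; x∈p∪q⁻; x∈p⇒x∉∁p; x∈∁p⇒x∉p; x∉p⇒x∈∁p; x∉∁p⇒x∈p)
open import Data.Vec using ([]; _∷_; here; there; tabulate)
open import Data.Vec.Properties using (lookup⇒[]=; []=⇒lookup; lookup∘tabulate)
open import Data.Product using (∃-syntax; _×_; _,_; proj₁; proj₂)
open import Data.Sum using (_⊎_; inj₁; inj₂; [_,_]′)
import Data.Sum as Sum
open import Data.Unit using (tt)
open import Data.Empty using (⊥-elim)
open import Function.Base using (_∘_)
open import Function.Bundles using (_⇔_; mk⇔)
open import Relation.Nullary using (¬_; yes; no; does)
open import Relation.Nullary.Decidable using (dec-true)
open import Relation.Unary using (Pred; Decidable)
open import Relation.Binary.PropositionalEquality as ≡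
  using (_≡_; _≢_; refl; trans; cong; cong₂; subst; subst₂)

subset : ∀ {n ℓ} {P : Pred (Fin n) ℓ} → Decidable P → Subset n
subset P? = tabulate (does ∘ P?)

∈-subset⁺ : ∀ {n ℓ} {P : Pred (Fin n) ℓ} (P? : Decidable P) {x} → P x → x ∈ subset P?
∈-subset⁺ P? {x} px = lookup⇒[]= x _ (trans (lookup∘tabulate (does ∘ P?) x) (dec-true (P? x) px))

∈-subset⁻ : ∀ {n ℓ} {P : Pred (Fin n) ℓ} (P? : Decidable P) {x} → x ∈ subset P? → P x
∈-subset⁻ P? {x} x∈ with P? x | trans (≡.sym (lookup∘tabulate (does ∘ P?) x)) ([]=⇒lookup x∈)
... | yes px | _  = px
... | no _   | ()

_⁻¹_ : ∀ {n m} → (Fin n → Fin m) → Subset m → Subset n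
f ⁻¹ q = subset (λ x → f x ∈? q)

∈⁻¹⁺ : ∀ {n m} (f : Fin n → Fin m) {q x} → f x ∈ q → x ∈ f ⁻¹ q
∈⁻¹⁺ f {q} = ∈-subset⁺ (λ x → f x ∈? q)

∈⁻¹⁻ : ∀ {n m} (f : Fin n → Fin m) {q x} → x ∈ f ⁻¹ q → f x ∈ q
∈⁻¹⁻ f {q} = ∈-subset⁻ (λ x → f x ∈? q)

∣p∪q∣≤∣p∣+∣q∣ : ∀ {n} (p q : Subset n) → ∣ p ∪ q ∣ ≤ ∣ p ∣ + ∣ q ∣
∣p∪q∣≤∣p∣+∣q∣ []          []          = z≤n
∣p∪q∣≤∣p∣+∣q∣ (true ∷ p)  (true ∷ q)  = s≤s (≤-trans (∣p∪q∣≤∣p∣+∣q∣ p q) (+-monoʳ-≤ ∣ p ∣ (n≤1+n ∣ q ∣)))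
∣p∪q∣≤∣p∣+∣q∣ (true ∷ p)  (false ∷ q) = s≤s (∣p∪q∣≤∣p∣+∣q∣ p q)
∣p∪q∣≤∣p∣+∣q∣ (false ∷ p) (true ∷ q)  =
  ≤-trans (s≤s (∣p∪q∣≤∣p∣+∣q∣ p q)) (≤-reflexive (≡.sym (+-suc ∣ p ∣ ∣ q ∣)))
∣p∪q∣≤∣p∣+∣q∣ (false ∷ p) (false ∷ q) = ∣p∪q∣≤∣p∣+∣q∣ p q

⊆∪⇒∣p∣≤∣q∣+∣r∣ : ∀ {n} {p q r : Subset n} → (∀ {x} → x ∈ p → x ∈ q ⊎ x ∈ r) → ∣ p ∣ ≤ ∣ q ∣ + ∣ r ∣
⊆∪⇒∣p∣≤∣q∣+∣r∣ {q = q} {r} p⊆q∪r = ≤-trans (p⊆q⇒∣p∣≤∣q∣ (x∈p∪q⁺ ∘ p⊆q∪r)) (∣p∪q∣≤∣p∣+∣q∣ q r)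

∣p∩q∣+∣p∩∁q∣≡∣p∣ : ∀ {n} (p q : Subset n) → ∣ p ∩ q ∣ + ∣ p ∩ ∁ q ∣ ≡ ∣ p ∣
∣p∩q∣+∣p∩∁q∣≡∣p∣ []          []          = refl
∣p∩q∣+∣p∩∁q∣≡∣p∣ (true ∷ p)  (true ∷ q)  = cong suc (∣p∩q∣+∣p∩∁q∣≡∣p∣ p q)
∣p∩q∣+∣p∩∁q∣≡∣p∣ (true ∷ p)  (false ∷ q) =
  trans (+-suc ∣ p ∩ q ∣ ∣ p ∩ ∁ q ∣) (cong suc (∣p∩q∣+∣p∩∁q∣≡∣p∣ p q))
∣p∩q∣+∣p∩∁q∣≡∣p∣ (false ∷ p) (_ ∷ q)     = ∣p∩q∣+∣p∩∁q∣≡∣p∣ p q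

∣p∣+∣∁p∣≡n : ∀ {n} (p : Subset n) → ∣ p ∣ + ∣ ∁ p ∣ ≡ n
∣p∣+∣∁p∣≡n []          = refl
∣p∣+∣∁p∣≡n (true ∷ p)  = cong suc (∣p∣+∣∁p∣≡n p)
∣p∣+∣∁p∣≡n (false ∷ p) = trans (+-suc ∣ p ∣ ∣ ∁ p ∣) (cong suc (∣p∣+∣∁p∣≡n p))

InjectiveOn : ∀ {n m} → (Fin n → Fin m) → Subset n → Set
InjectiveOn f p = ∀ {x y} → x ∈ p → y ∈ p → f x ≡ f y → x ≡ y

injectiveOn⇒∣p∣≤∣q∣ : ∀ {n m} (f : Fin n → Fin m) {p : Subset n} {q : Subset m} →
                      (∀ {x} → x ∈ p → f x ∈ q) → InjectiveOn f p → ∣ p ∣ ≤ ∣ q ∣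
injectiveOn⇒∣p∣≤∣q∣ f {[]}        _    _   = z≤n
injectiveOn⇒∣p∣≤∣q∣ f {false ∷ p} into inj =
  injectiveOn⇒∣p∣≤∣q∣ (f ∘ suc) (into ∘ there) (λ x∈ y∈ eq → suc-injective (inj (there x∈) (there y∈) eq))
injectiveOn⇒∣p∣≤∣q∣ f {true ∷ p}  {q} into inj = ≤-<-trans ∣p∣≤∣q-f0∣ (x∈p⇒∣p-x∣<∣p∣ (into here))
  where
  ∣p∣≤∣q-f0∣ : ∣ p ∣ ≤ ∣ q - f zero ∣
  ∣p∣≤∣q-f0∣ = injectiveOn⇒∣p∣≤∣q∣ (f ∘ suc)
    (λ x∈ → x∈p∧x≢y⇒x∈p-y (into (there x∈)) (λ eq → 0≢1+n (inj here (there x∈) (≡.sym eq))))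
    (λ x∈ y∈ eq → suc-injective (inj (there x∈) (there y∈) eq))

inverseOn⇒∣p∣≡∣q∣ : ∀ {n m} (f : Fin n → Fin m) (g : Fin m → Fin n) {p : Subset n} {q : Subset m} →
                    (∀ {x} → x ∈ p → f x ∈ q) → (∀ {y} → y ∈ q → g y ∈ p) →
                    (∀ {x} → x ∈ p → g (f x) ≡ x) → (∀ {y} → y ∈ q → f (g y) ≡ y) → ∣ p ∣ ≡ ∣ q ∣
inverseOn⇒∣p∣≡∣q∣ f g f∈ g∈ gf fg = ≤-antisym
  (injectiveOn⇒∣p∣≤∣q∣ f f∈ (λ x∈ y∈ eq → trans (≡.sym (gf x∈)) (trans (cong g eq) (gf y∈))))
  (injectiveOn⇒∣p∣≤∣q∣ g g∈ (λ x∈ y∈ eq → trans (≡.sym (fg x∈)) (trans (cong f eq) (fg y∈))))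

sumOver-const : ∀ {n} (p : Subset n) c → sumOver p (λ _ → c) ≡ ∣ p ∣ * c
sumOver-const []          c = refl
sumOver-const (true ∷ p)  c = cong (c +_) (sumOver-const p c)
sumOver-const (false ∷ p) c = sumOver-const p c

weightGF≡ : ∀ {n} k (C₁ C₂ : Subset n) → weightGF k (C₁ , C₂) ≡ ∣ C₁ ∣ * suc k + ∣ C₂ ∣
weightGF≡ k C₁ C₂ = cong₂ _+_ (sumOver-const C₁ (suc k)) (trans (sumOver-const C₂ 1) (*-identityʳ ∣ C₂ ∣))

[m+m]/2≡m : ∀ m → (m + m) / 2 ≡ m
[m+m]/2≡m m = trans (cong (_/ 2) (m+m≡m*2 m)) (m*n/n≡m m 2)
  where
  m+m≡m*2 : ∀ m → m + m ≡ m * 2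
  m+m≡m*2 = solve-∀

budget-split : ∀ t k → t * (k + 2) + k ≡ t * suc k + (k + t)
budget-split = solve-∀

budget⇒c₁≤t : ∀ {c₁ c₂ t} k → c₁ * suc k + c₂ ≤ t * suc k + (k + t) → t ≤ c₂ → c₁ ≤ t
budget⇒c₁≤t {c₁} {c₂} {t} k W t≤c₂ = ≮⇒≥ λ t<c₁ → <-irrefl refl (begin-strict
  t * suc k + (k + t) <⟨ ≤-reflexive (one-more-edge t k) ⟩
  suc t * suc k + t   ≤⟨ +-mono-≤ (*-monoˡ-≤ (suc k) t<c₁) t≤c₂ ⟩
  c₁ * suc k + c₂     ≤⟨ W ⟩
  t * suc k + (k + t) ∎)
  where
  open ≤-Reasoning
  one-more-edge : ∀ t k → suc (t * suc k + (k + t)) ≡ suc t * suc k + t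
  one-more-edge = solve-∀

budget⇒c₂≤k+t : ∀ {c₁ c₂ t} k → c₁ * suc k + c₂ ≤ t * suc k + (k + t) → t ≤ c₁ → c₂ ≤ k + t
budget⇒c₂≤k+t {c₂ = c₂} {t} k W t≤c₁ =
  +-cancelˡ-≤ (t * suc k) c₂ _ (≤-trans (+-monoˡ-≤ c₂ (*-monoˡ-≤ (suc k) t≤c₁)) W)

Independent : ∀ {n} → Graph n → Subset n → Set
Independent G I = ∀ u v → u ∈ I → v ∈ I → ¬ Adj G u v

independent⇒some-end∉ : ∀ {n} {G : Graph n} {I u v} → Independent G I → Adj G u v → u ∉ I ⊎ v ∉ I
independent⇒some-end∉ {I = I} {u} {v} ind adj with u ∈? I
... | yes u∈I = inj₂ (λ v∈I → ind u v u∈I v∈I adj)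
... | no  u∉I = inj₁ u∉I

Adj-sym : ∀ {n} (G : Graph n) {u v} → Adj G u v → Adj G v u
Adj-sym G {u} {v} = trans (sym G v u)

¬Adj-refl : ∀ {n} (G : Graph n) v → ¬ Adj G v v
¬Adj-refl G v adj with trans (≡.sym adj) (irrefl G v)
... | ()

module Matched {n : ℕ} {G : Graph n} (M : PerfectMatching G) where

  end₁ end₂ : Fin (m M) → Fin n
  end₁ i = proj₁ (edge M i)
  end₂ i = proj₂ (edge M i)

  edgeOf : Fin n → Fin (m M)
  edgeOf v = proj₁ (covers M v)

  edgeOf-end : ∀ v → EndOf M v (edgeOf v)
  edgeOf-end v = proj₂ (covers M v)

  edgeOf-unique : ∀ {v i} → EndOf M v i → edgeOf v ≡ i
  edgeOf-unique {v} {i} = unique M v (edgeOf v) i (edgeOf-end v)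

  edgeOf-end₁ : ∀ i → edgeOf (end₁ i) ≡ i
  edgeOf-end₁ i = edgeOf-unique (inj₁ refl)

  edgeOf-end₂ : ∀ i → edgeOf (end₂ i) ≡ i
  edgeOf-end₂ i = edgeOf-unique (inj₂ refl)

  end-of-edgeOf : ∀ {v i} → edgeOf v ≡ i → EndOf M v i
  end-of-edgeOf {v} refl = edgeOf-end v

  end₁≢end₂ : ∀ i → end₁ i ≢ end₂ i
  end₁≢end₂ i eq = ¬Adj-refl G (end₂ i) (subst (λ u → Adj G u (end₂ i)) eq (isEdge M i))

  two-ends : ∀ {u v w} → edgeOf u ≡ edgeOf w → edgeOf v ≡ edgeOf w → u ≢ v → w ≡ u ⊎ w ≡ v
  two-ends {u} {v} {w} eu ev u≢v with end-of-edgeOf eu | end-of-edgeOf ev | edgeOf-end w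
  ... | inj₁ u₁ | inj₁ v₁ | _       = ⊥-elim (u≢v (trans u₁ (≡.sym v₁)))
  ... | inj₂ u₂ | inj₂ v₂ | _       = ⊥-elim (u≢v (trans u₂ (≡.sym v₂)))
  ... | inj₁ u₁ | _       | inj₁ w₁ = inj₁ (trans w₁ (≡.sym u₁))
  ... | inj₂ u₂ | _       | inj₂ w₂ = inj₁ (trans w₂ (≡.sym u₂))
  ... | _       | inj₁ v₁ | inj₁ w₁ = inj₂ (trans w₁ (≡.sym v₁))
  ... | _       | inj₂ v₂ | inj₂ w₂ = inj₂ (trans w₂ (≡.sym v₂))

  same-edge⇒Adj : ∀ {u v} → edgeOf u ≡ edgeOf v → u ≢ v → Adj G u v
  same-edge⇒Adj {u} {v} eq u≢v with end-of-edgeOf eq | edgeOf-end v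
  ... | inj₁ u₁ | inj₂ v₂ = subst₂ (Adj G) (≡.sym u₁) (≡.sym v₂) (isEdge M (edgeOf v))
  ... | inj₂ u₂ | inj₁ v₁ = Adj-sym G (subst₂ (Adj G) (≡.sym v₁) (≡.sym u₂) (isEdge M (edgeOf v)))
  ... | inj₁ u₁ | inj₁ v₁ = ⊥-elim (u≢v (trans u₁ (≡.sym v₁)))
  ... | inj₂ u₂ | inj₂ v₂ = ⊥-elim (u≢v (trans u₂ (≡.sym v₂)))

  independent⇒edgeOf-injective : ∀ {I} → Independent G I → InjectiveOn edgeOf I
  independent⇒edgeOf-injective ind {u} {v} u∈I v∈I eq with u ≟ v
  ... | yes u≡v = u≡v
  ... | no  u≢v = ⊥-elim (ind u v u∈I v∈I (same-edge⇒Adj eq u≢v))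

  ∣edgeOf⁻¹q∣≡∣q∣+∣q∣ : ∀ (q : Subset (m M)) → ∣ edgeOf ⁻¹ q ∣ ≡ ∣ q ∣ + ∣ q ∣
  ∣edgeOf⁻¹q∣≡∣q∣+∣q∣ q = begin
    ∣ V ∣                                   ≡⟨ ≡.sym (∣p∩q∣+∣p∩∁q∣≡∣p∣ V firstEnds) ⟩
    ∣ V ∩ firstEnds ∣ + ∣ V ∩ ∁ firstEnds ∣ ≡⟨ cong₂ _+_ ∣V∩firstEnds∣≡∣q∣ ∣V∖firstEnds∣≡∣q∣ ⟩
    ∣ q ∣ + ∣ q ∣                           ∎
    where
    open ≡.≡-Reasoning
    first? : Decidable (λ v → v ≡ end₁ (edgeOf v))
    first? v = v ≟ end₁ (edgeOf v)

    V firstEnds : Subset n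
    V = edgeOf ⁻¹ q
    firstEnds = subset first?

    edgeOf∈q : ∀ {x} → x ∈ V ∩ firstEnds ⊎ x ∈ V ∩ ∁ firstEnds → edgeOf x ∈ q
    edgeOf∈q = ∈⁻¹⁻ edgeOf ∘ [ proj₁ ∘ x∈p∩q⁻ V _ , proj₁ ∘ x∈p∩q⁻ V _ ]′

    ∣V∩firstEnds∣≡∣q∣ : ∣ V ∩ firstEnds ∣ ≡ ∣ q ∣
    ∣V∩firstEnds∣≡∣q∣ = inverseOn⇒∣p∣≡∣q∣ edgeOf end₁ (edgeOf∈q ∘ inj₁)
      (λ {i} i∈q → x∈p∩q⁺ ( ∈⁻¹⁺ edgeOf (subst (_∈ q) (≡.sym (edgeOf-end₁ i)) i∈q)
                          , ∈-subset⁺ first? (cong end₁ (≡.sym (edgeOf-end₁ i)))))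
      (λ x∈ → ≡.sym (∈-subset⁻ first? (proj₂ (x∈p∩q⁻ V _ x∈))))
      (λ {i} _ → edgeOf-end₁ i)

    end₂∉firstEnds : ∀ i → end₂ i ∉ firstEnds
    end₂∉firstEnds i e = end₁≢end₂ i (≡.sym (trans (∈-subset⁻ first? e) (cong end₁ (edgeOf-end₂ i))))

    second-end : ∀ {v} → v ∉ firstEnds → end₂ (edgeOf v) ≡ v
    second-end {v} v∉ with edgeOf-end v
    ... | inj₁ v₁ = ⊥-elim (v∉ (∈-subset⁺ first? v₁))
    ... | inj₂ v₂ = ≡.sym v₂

    ∣V∖firstEnds∣≡∣q∣ : ∣ V ∩ ∁ firstEnds ∣ ≡ ∣ q ∣
    ∣V∖firstEnds∣≡∣q∣ = inverseOn⇒∣p∣≡∣q∣ edgeOf end₂ (edgeOf∈q ∘ inj₂)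
      (λ {i} i∈q → x∈p∩q⁺ ( ∈⁻¹⁺ edgeOf (subst (_∈ q) (≡.sym (edgeOf-end₂ i)) i∈q)
                          , x∉p⇒x∈∁p (end₂∉firstEnds i)))
      (λ x∈ → second-end (x∈∁p⇒x∉p (proj₂ (x∈p∩q⁻ V _ x∈))))
      (λ {i} _ → edgeOf-end₂ i)

  n≡m+m : n ≡ m M + m M
  n≡m+m = trans (≤-antisym n≤∣edgeOf⁻¹⊤∣ (∣p∣≤n (edgeOf ⁻¹ ⊤)))
                (trans (∣edgeOf⁻¹q∣≡∣q∣+∣q∣ ⊤) (cong₂ _+_ (∣⊤∣≡n (m M)) (∣⊤∣≡n (m M))))
    where
    n≤∣edgeOf⁻¹⊤∣ : n ≤ ∣ edgeOf ⁻¹ ⊤ ∣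
    n≤∣edgeOf⁻¹⊤∣ = subst (_≤ ∣ edgeOf ⁻¹ ⊤ ∣) (∣⊤∣≡n n) (p⊆q⇒∣p∣≤∣q∣ {p = ⊤} (λ _ → ∈⁻¹⁺ edgeOf ∈⊤))

  n/2≡m : n / 2 ≡ m M
  n/2≡m = trans (cong (_/ 2) n≡m+m) ([m+m]/2≡m (m M))

  InVF⇒edgeOf∈ : ∀ {F v} → InVF M F v → edgeOf v ∈ F
  InVF⇒edgeOf∈ {F} (i , i∈F , end) = subst (_∈ F) (≡.sym (edgeOf-unique end)) i∈F

  edgeOf∈⇒InVF : ∀ {F v} → edgeOf v ∈ F → InVF M F v
  edgeOf∈⇒InVF {v = v} e∈F = edgeOf v , e∈F , edgeOf-end v

  edgesMeeting : Subset n → Subset (m M)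
  edgesMeeting A = end₁ ⁻¹ A ∪ end₂ ⁻¹ A

  edgeOf∈edgesMeeting : ∀ {A v} → v ∈ A → edgeOf v ∈ edgesMeeting A
  edgeOf∈edgesMeeting {A} {v} v∈A with edgeOf-end v
  ... | inj₁ v₁ = x∈p∪q⁺ (inj₁ (∈⁻¹⁺ end₁ (subst (_∈ A) v₁ v∈A)))
  ... | inj₂ v₂ = x∈p∪q⁺ (inj₂ (∈⁻¹⁺ end₂ (subst (_∈ A) v₂ v∈A)))

  edgesMeeting⇒end∈ : ∀ {A i} → i ∈ edgesMeeting A → ∃[ w ] (w ∈ A × edgeOf w ≡ i)
  edgesMeeting⇒end∈ {A} {i} i∈ with x∈p∪q⁻ (end₁ ⁻¹ A) (end₂ ⁻¹ A) i∈
  ... | inj₁ e₁ = end₁ i , ∈⁻¹⁻ end₁ e₁ , edgeOf-end₁ i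
  ... | inj₂ e₂ = end₂ i , ∈⁻¹⁻ end₂ e₂ , edgeOf-end₂ i

module FromBipartition {n : ℕ} {G : Graph n} (M : PerfectMatching G) {X A B : Subset n}
  (outside-X : ∀ v → v ∉ X → v ∈ A ⊎ v ∈ B) (A∩B≡∅ : ∀ v → v ∈ A → v ∉ B)
  (A-indep : Independent G A) (B-indep : Independent G B) where

  open Matched M

  H F : Subset (m M)
  H = edgesMeeting A
  F = ∁ H

  C₁ C₂ : Subset n
  C₁ = edgeOf ⁻¹ H ∩ ∁ A
  C₂ = ∁ B

  ∈C₁ : ∀ {v} → ¬ InVF M F v → v ∉ A → v ∈ C₁
  ∈C₁ v∉VF v∉A = x∈p∩q⁺ (∈⁻¹⁺ edgeOf (x∉∁p⇒x∈p (v∉VF ∘ edgeOf∈⇒InVF)) , x∉p⇒x∈∁p v∉A)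

  rung-covered : ∀ {v} → ¬ InVF M F v → inj₁ v ∈GF (C₁ , C₂) ⊎ inj₂ v ∈GF (C₁ , C₂)
  rung-covered {v} v∉VF with v ∈? A
  ... | yes v∈A = inj₂ (x∉p⇒x∈∁p (A∩B≡∅ v v∈A))
  ... | no  v∉A = inj₁ (∈C₁ v∉VF v∉A)

  isCover : IsVertexCoverGF M F (C₁ , C₂)
  isCover = vertices , edges
    where
    vertices : ∀ x → x ∈GF (C₁ , C₂) → VertexGF M F x
    vertices (inj₁ v) v∈C₁ = x∈p⇒x∉∁p (∈⁻¹⁻ edgeOf (proj₁ (x∈p∩q⁻ _ _ v∈C₁))) ∘ InVF⇒edgeOf∈
    vertices (inj₂ v) _    = tt

    edges : ∀ x y → EdgeGF M F x y → x ∈GF (C₁ , C₂) ⊎ y ∈GF (C₁ , C₂)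
    edges (inj₁ u) (inj₂ .u) (refl , u∉VF)       = rung-covered u∉VF
    edges (inj₂ u) (inj₁ .u) (refl , u∉VF)       = Sum.swap (rung-covered u∉VF)
    edges (inj₁ u) (inj₁ v)  (adj , u∉VF , v∉VF) =
      Sum.map (∈C₁ u∉VF) (∈C₁ v∉VF) (independent⇒some-end∉ {G = G} A-indep adj)
    edges (inj₂ u) (inj₂ v)  adj                 =
      Sum.map x∉p⇒x∈∁p x∉p⇒x∈∁p (independent⇒some-end∉ {G = G} B-indep adj)

  ∣A∣≤∣H∣ : ∣ A ∣ ≤ ∣ H ∣
  ∣A∣≤∣H∣ = injectiveOn⇒∣p∣≤∣q∣ edgeOf edgeOf∈edgesMeeting (independent⇒edgeOf-injective A-indep)

  ∣C₁∣≤∣H∣ : ∣ C₁ ∣ ≤ ∣ H ∣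
  ∣C₁∣≤∣H∣ = injectiveOn⇒∣p∣≤∣q∣ edgeOf (∈⁻¹⁻ edgeOf ∘ proj₁ ∘ x∈p∩q⁻ _ _) injective
    where
    ∉A : ∀ {v} → v ∈ C₁ → v ∉ A
    ∉A = x∈∁p⇒x∉p ∘ proj₂ ∘ x∈p∩q⁻ _ _

    injective : InjectiveOn edgeOf C₁
    injective {u} {v} u∈ v∈ eq with u ≟ v | edgesMeeting⇒end∈ (∈⁻¹⁻ edgeOf (proj₁ (x∈p∩q⁻ _ _ v∈)))
    ... | yes u≡v | _ = u≡v
    ... | no  u≢v | w , w∈A , w~v with two-ends (trans eq (≡.sym w~v)) (≡.sym w~v) u≢v
    ...   | inj₁ refl = ⊥-elim (∉A u∈ w∈A)
    ...   | inj₂ refl = ⊥-elim (∉A v∈ w∈A)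

  ∣C₂∣≤∣X∣+∣A∣ : ∣ C₂ ∣ ≤ ∣ X ∣ + ∣ A ∣
  ∣C₂∣≤∣X∣+∣A∣ = ⊆∪⇒∣p∣≤∣q∣+∣r∣ split
    where
    split : ∀ {v} → v ∈ ∁ B → v ∈ X ⊎ v ∈ A
    split {v} v∉B with v ∈? X
    ... | yes v∈X = inj₁ v∈X
    ... | no  v∉X = inj₂ (Sum.fromInj₁ (⊥-elim ∘ x∈∁p⇒x∉p v∉B) (outside-X v v∉X))

  ∣F∣≤l : ∀ {l} → n / 2 ≤ ∣ A ∣ + l → ∣ F ∣ ≤ l
  ∣F∣≤l {l} n/2≤∣A∣+l = +-cancelˡ-≤ ∣ H ∣ ∣ F ∣ l (begin
    ∣ H ∣ + ∣ F ∣ ≡⟨ trans (∣p∣+∣∁p∣≡n H) (≡.sym n/2≡m) ⟩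
    n / 2         ≤⟨ n/2≤∣A∣+l ⟩
    ∣ A ∣ + l     ≤⟨ +-monoˡ-≤ l ∣A∣≤∣H∣ ⟩
    ∣ H ∣ + l     ∎)
    where open ≤-Reasoning

  weight-bound : ∀ {k} → ∣ X ∣ ≤ k → weightGF k (C₁ , C₂) ≤ (n / 2 ∸ ∣ F ∣) * (k + 2) + k
  weight-bound {k} ∣X∣≤k = begin
    weightGF k (C₁ , C₂)          ≡⟨ weightGF≡ k C₁ C₂ ⟩
    ∣ C₁ ∣ * suc k + ∣ C₂ ∣       ≤⟨ +-mono-≤ (*-monoˡ-≤ (suc k) ∣C₁∣≤∣H∣) ∣C₂∣≤k+∣H∣ ⟩
    ∣ H ∣ * suc k + (k + ∣ H ∣)   ≡⟨ ≡.sym (budget-split ∣ H ∣ k) ⟩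
    ∣ H ∣ * (k + 2) + k           ≡⟨ cong (λ t → t * (k + 2) + k) (≡.sym n/2∸∣F∣≡∣H∣) ⟩
    (n / 2 ∸ ∣ F ∣) * (k + 2) + k ∎
    where
    open ≤-Reasoning
    ∣C₂∣≤k+∣H∣ : ∣ C₂ ∣ ≤ k + ∣ H ∣
    ∣C₂∣≤k+∣H∣ = ≤-trans ∣C₂∣≤∣X∣+∣A∣ (+-mono-≤ ∣X∣≤k ∣A∣≤∣H∣)

    n/2∸∣F∣≡∣H∣ : n / 2 ∸ ∣ F ∣ ≡ ∣ H ∣
    n/2∸∣F∣≡∣H∣ = trans (cong (_∸ ∣ F ∣) (trans n/2≡m (≡.sym (∣p∣+∣∁p∣≡n H)))) (m+n∸n≡m ∣ H ∣ ∣ F ∣)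

module FromCover {n : ℕ} {G : Graph n} (M : PerfectMatching G) {F : Subset (m M)} {C₁ C₂ : Subset n}
  (covers-edges : ∀ x y → EdgeGF M F x y → x ∈GF (C₁ , C₂) ⊎ y ∈GF (C₁ , C₂)) where

  open Matched M

  U A B X : Subset n
  U = edgeOf ⁻¹ ∁ F
  A = U ∩ ∁ C₁
  B = ∁ C₂
  X = C₂ ∩ ∁ A

  ∉VF : ∀ {v} → v ∈ U → ¬ InVF M F v
  ∉VF v∈U = x∈∁p⇒x∉p (∈⁻¹⁻ edgeOf v∈U) ∘ InVF⇒edgeOf∈

  A⊆U : ∀ {v} → v ∈ A → v ∈ U
  A⊆U = proj₁ ∘ x∈p∩q⁻ U _

  A∩C₁≡∅ : ∀ {v} → v ∈ A → v ∉ C₁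
  A∩C₁≡∅ = x∈∁p⇒x∉p ∘ proj₂ ∘ x∈p∩q⁻ U _

  A⊆C₂ : ∀ {v} → v ∈ A → v ∈ C₂
  A⊆C₂ v∈A = Sum.fromInj₂ (⊥-elim ∘ A∩C₁≡∅ v∈A) (covers-edges (inj₁ _) (inj₂ _) (refl , ∉VF (A⊆U v∈A)))

  A-indep : Independent G A
  A-indep u v u∈A v∈A adj =
    [ A∩C₁≡∅ u∈A , A∩C₁≡∅ v∈A ]′ (covers-edges (inj₁ u) (inj₁ v) (adj , ∉VF (A⊆U u∈A) , ∉VF (A⊆U v∈A)))

  B-indep : Independent G B
  B-indep u v u∈B v∈B adj = [ x∈∁p⇒x∉p u∈B , x∈∁p⇒x∉p v∈B ]′ (covers-edges (inj₂ u) (inj₂ v) adj)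

  isBipartition : IsBipartition G X A B
  isBipartition =
      (λ v v∈A v∈X → x∈∁p⇒x∉p (proj₂ (x∈p∩q⁻ C₂ _ v∈X)) v∈A)
    , (λ v v∈B v∈X → x∈∁p⇒x∉p v∈B (proj₁ (x∈p∩q⁻ C₂ _ v∈X)))
    , outside-X
    , (λ v v∈A → x∈p⇒x∉∁p (A⊆C₂ v∈A))
    , A-indep
    , B-indep
    where
    outside-X : ∀ v → v ∉ X → v ∈ A ⊎ v ∈ B
    outside-X v v∉X with v ∈? A | v ∈? C₂
    ... | yes v∈A | _        = inj₁ v∈A
    ... | no  v∉A | yes v∈C₂ = ⊥-elim (v∉X (x∈p∩q⁺ (v∈C₂ , x∉p⇒x∈∁p v∉A)))
    ... | no  _   | no  v∉C₂ = inj₂ (x∉p⇒x∈∁p v∉C₂)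

  ∣A∣≤∣∁F∣ : ∣ A ∣ ≤ ∣ ∁ F ∣
  ∣A∣≤∣∁F∣ = injectiveOn⇒∣p∣≤∣q∣ edgeOf (∈⁻¹⁻ edgeOf ∘ A⊆U) (independent⇒edgeOf-injective A-indep)

  ∣B∣≤m : ∣ B ∣ ≤ m M
  ∣B∣≤m = ≤-trans (injectiveOn⇒∣p∣≤∣q∣ edgeOf (λ _ → ∈⊤) (independent⇒edgeOf-injective B-indep)) (∣p∣≤n ⊤)

  ∣∁F∣+∣∁F∣≤∣C₁∣+∣A∣ : ∣ ∁ F ∣ + ∣ ∁ F ∣ ≤ ∣ C₁ ∣ + ∣ A ∣
  ∣∁F∣+∣∁F∣≤∣C₁∣+∣A∣ = subst (_≤ ∣ C₁ ∣ + ∣ A ∣) (∣edgeOf⁻¹q∣≡∣q∣+∣q∣ (∁ F)) (⊆∪⇒∣p∣≤∣q∣+∣r∣ split)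
    where
    split : ∀ {v} → v ∈ U → v ∈ C₁ ⊎ v ∈ A
    split {v} v∈U with v ∈? C₁
    ... | yes v∈C₁ = inj₁ v∈C₁
    ... | no  v∉C₁ = inj₂ (x∈p∩q⁺ (v∈U , x∉p⇒x∈∁p v∉C₁))

  ∣A∣+∣X∣≤∣C₂∣ : ∣ A ∣ + ∣ X ∣ ≤ ∣ C₂ ∣
  ∣A∣+∣X∣≤∣C₂∣ = ≤-trans (+-monoˡ-≤ ∣ X ∣ (p⊆q⇒∣p∣≤∣q∣ (λ v∈A → x∈p∩q⁺ (A⊆C₂ v∈A , v∈A))))
                         (≤-reflexive (∣p∩q∣+∣p∩∁q∣≡∣p∣ C₂ A))

  module _ {k} (W : weightGF k (C₁ , C₂) ≤ (n / 2 ∸ ∣ F ∣) * (k + 2) + k) where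
    open ≤-Reasoning

    private
      t : ℕ
      t = ∣ ∁ F ∣

      n/2∸∣F∣≡t : n / 2 ∸ ∣ F ∣ ≡ t
      n/2∸∣F∣≡t = trans (cong (_∸ ∣ F ∣) (trans n/2≡m (≡.sym (∣p∣+∣∁p∣≡n F)))) (m+n∸m≡n ∣ F ∣ t)

      W′ : ∣ C₁ ∣ * suc k + ∣ C₂ ∣ ≤ t * suc k + (k + t)
      W′ = begin
        ∣ C₁ ∣ * suc k + ∣ C₂ ∣       ≡⟨ ≡.sym (weightGF≡ k C₁ C₂) ⟩
        weightGF k (C₁ , C₂)          ≤⟨ W ⟩
        (n / 2 ∸ ∣ F ∣) * (k + 2) + k ≡⟨ cong (λ s → s * (k + 2) + k) n/2∸∣F∣≡t ⟩
        t * (k + 2) + k               ≡⟨ budget-split t k ⟩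
        t * suc k + (k + t)           ∎

      t≤∣C₂∣ : t ≤ ∣ C₂ ∣
      t≤∣C₂∣ = ≤-trans (m≤n+m t ∣ F ∣) (≤-trans (≤-reflexive (∣p∣+∣∁p∣≡n F)) m≤∣C₂∣)
        where
        m≤∣C₂∣ : m M ≤ ∣ C₂ ∣
        m≤∣C₂∣ = +-cancelʳ-≤ (m M) (m M) ∣ C₂ ∣ (begin
          m M + m M     ≡⟨ trans (≡.sym n≡m+m) (≡.sym (∣p∣+∣∁p∣≡n C₂)) ⟩
          ∣ C₂ ∣ + ∣ B ∣ ≤⟨ +-monoʳ-≤ ∣ C₂ ∣ ∣B∣≤m ⟩
          ∣ C₂ ∣ + m M  ∎)

      ∣C₁∣≤t : ∣ C₁ ∣ ≤ t
      ∣C₁∣≤t = budget⇒c₁≤t k W′ t≤∣C₂∣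

      t≤∣A∣ : t ≤ ∣ A ∣
      t≤∣A∣ = +-cancelˡ-≤ t t ∣ A ∣ (≤-trans ∣∁F∣+∣∁F∣≤∣C₁∣+∣A∣ (+-monoˡ-≤ ∣ A ∣ ∣C₁∣≤t))

      t≤∣C₁∣ : t ≤ ∣ C₁ ∣
      t≤∣C₁∣ = +-cancelʳ-≤ t t ∣ C₁ ∣ (≤-trans ∣∁F∣+∣∁F∣≤∣C₁∣+∣A∣ (+-monoʳ-≤ ∣ C₁ ∣ ∣A∣≤∣∁F∣))

    ∣X∣≤k : ∣ X ∣ ≤ k
    ∣X∣≤k = +-cancelˡ-≤ ∣ A ∣ ∣ X ∣ k (begin
      ∣ A ∣ + ∣ X ∣ ≤⟨ ∣A∣+∣X∣≤∣C₂∣ ⟩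
      ∣ C₂ ∣        ≤⟨ budget⇒c₂≤k+t k W′ t≤∣C₁∣ ⟩
      k + t         ≤⟨ +-monoʳ-≤ k t≤∣A∣ ⟩
      k + ∣ A ∣     ≡⟨ +-comm k ∣ A ∣ ⟩
      ∣ A ∣ + k     ∎)

    n/2≤∣A∣+l : ∀ {l} → ∣ F ∣ ≤ l → n / 2 ≤ ∣ A ∣ + l
    n/2≤∣A∣+l {l} ∣F∣≤l = begin
      n / 2         ≡⟨ trans n/2≡m (≡.sym (∣p∣+∣∁p∣≡n F)) ⟩
      ∣ F ∣ + t     ≤⟨ +-mono-≤ ∣F∣≤l t≤∣A∣ ⟩
      l + ∣ A ∣     ≡⟨ +-comm l ∣ A ∣ ⟩
      ∣ A ∣ + l     ∎

lemma3p7 : ∀ {n} (G : Graph n) (M : PerfectMatching G) (k l : ℕ) →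
    (∃[ X ] ∃[ A ] ∃[ B ] (∣ X ∣ ≤ k × IsBipartition G X A B × n / 2 ≤ ∣ A ∣ + l))
    ⇔
    (∃[ F ] (∣ F ∣ ≤ l × ∃[ C ] (IsVertexCoverGF M F C
        × weightGF k C ≤ (n / 2 ∸ ∣ F ∣) * (k + 2) + k)))
lemma3p7 G M k l = mk⇔
  (λ (X , A , B , ∣X∣≤k , (_ , _ , outside-X , A∩B≡∅ , A-indep , B-indep) , n/2≤∣A∣+l) →
    let open FromBipartition M outside-X A∩B≡∅ A-indep B-indep
    in  F , ∣F∣≤l n/2≤∣A∣+l , (C₁ , C₂) , isCover , weight-bound ∣X∣≤k)
  (λ (F , ∣F∣≤l , (C₁ , C₂) , (_ , covers-edges) , W) →
    let open FromCover M covers-edges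
    in  X , A , B , ∣X∣≤k W , isBipartition , n/2≤∣A∣+l W ∣F∣≤l)
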